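{- Let $\lambda\in\mathbb{C}$ with $\lambda\neq 1$ and $\lambda\neq 0$, let $n\geq 1$ be an integer and $a\in\mathbb{Z}_+=\{0,1,2,\dots\}$. Then \[ \sum_{l=0}^{an}\binom{an}{l}(-\lambda)^{ -l}(x+l)^{n-1}=\frac{1}{(1-\lambda)^n}\sum_{l=0}^{(a+1)n}\binom{(a+1)n}{l}(-\lambda)^{n-l}\,H_{n-1}^{(n)}(x+l\mid\lambda). \]
   Context: For $\lambda\in\mathbb{C}$, $\lambda\neq1$, and $\alpha\in\mathbb{R}$, the Frobenius–Euler polynomials of order $\alpha$ are defined by the generating function $\left(\frac{1-\lambda}{e^t-\lambda}\right)^{\alpha}e^{xt}=\sum_{n=0}^{\infty}H_n^{(\alpha)}(x\mid\lambda)\frac{t^n}{n!}$. The convention $0^0=1$ is used. -}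

module Defs where

open import Level using (Level)
open import Algebra.Bundles using (CommutativeRing)
open import Data.Nat as ℕ using (ℕ; zero; suc; _≤?_)
open import Data.Nat.Combinatorics using (_C_)
open import Data.Integer as ℤ using (ℤ; +_; -[1+_])
open import Relation.Nullary using (yes; no)

-- Everything is developed over an arbitrary commutative ring R
-- (stand-in for ℂ, which agda-stdlib does not have).
module FrobeniusEuler {c ℓ : Level} (R : CommutativeRing c ℓ) where
  open CommutativeRing R

  fromℕ : ℕ → Carrier
  fromℕ zero    = 0#
  fromℕ (suc n) = 1# + fromℕ n

  _^_ : Carrier → ℕ → Carrier
  u ^ zero  = 1#
  u ^ suc n = u * (u ^ n)

  zpow : Carrier → Carrier → ℤ → Carrier
  zpow u uinv (+ n)      = u ^ n
  zpow u uinv -[1+ n ]   = uinv ^ suc n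

  sumTo : ℕ → (ℕ → Carrier) → Carrier
  sumTo zero    f = f 0
  sumTo (suc n) f = sumTo n f + f (suc n)

  -- binomial convolution = product of exponential generating functions:
  -- (Σ f_k t^k/k!)(Σ g_k t^k/k!) = Σ (f ⋆ g)_n t^n/n!
  _⋆_ : (ℕ → Carrier) → (ℕ → Carrier) → (ℕ → Carrier)
  (f ⋆ g) n = sumTo n (λ k → fromℕ (n C k) * (f k * g (n ℕ.∸ k)))

  -- Coefficients B_k (Frobenius–Euler numbers, order 1) of the EGF
  -- (1-λ)/(e^t-λ) = Σ B_k t^k/k!.  Here μ is the inverse of (1-λ).
  -- Comparing coefficients in (e^t-λ)·Σ B_k t^k/k! = 1-λ gives
  -- B_0 = 1 and, for k ≥ 1, (1-λ) B_k + Σ_{j<k} C(k,j) B_j = 0, i.e.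
  -- B_{k} = -μ Σ_{j<k} C(k,j) B_j.
  -- tab n j is B_j for every j ≤ n (course-of-values recursion).
  tab : Carrier → ℕ → ℕ → Carrier
  tab μ zero    j = 1#
  tab μ (suc n) j with j ≤? n
  ... | yes _ = tab μ n j
  ... | no  _ = - (μ * sumTo n (λ i → fromℕ (suc n C i) * tab μ n i))

  FEnum : Carrier → ℕ → Carrier
  FEnum μ k = tab μ k k

  -- EGF coefficients of ((1-λ)/(e^t-λ))^m  (m-fold product)
  δ : ℕ → Carrier
  δ zero    = 1#
  δ (suc _) = 0#

  FEpow : Carrier → ℕ → (ℕ → Carrier)
  FEpow μ zero    = δ
  FEpow μ (suc m) = FEnum μ ⋆ FEpow μ m

  -- Frobenius–Euler polynomial H_k^{(m)}(y | λ): the k-th EGF coefficient of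
  -- ((1-λ)/(e^t-λ))^m e^{yt}, where e^{yt} has EGF coefficients y^k.
  H : Carrier → ℕ → ℕ → Carrier → Carrier
  H μ m k y = (FEpow μ m ⋆ (λ i → y ^ i)) k

module Submission where

-- Write u = -λ, v = -λ⁻¹ (so v·u = 1) and E for the shift g l ↦ g (l + 1) on
-- sequences.  The sum  Σ_l C(j,l) u^(j-l) g l  is ((E + u)^j g)(0).
--   * Both sides of the theorem are of this shape after pulling out v^(an):
--     the integer powers of u occurring there are  v^(an)·u^(M-l)  (M the
--     length of the sum).
--   * (E + u)^(n + an) = (E + u)^(an) ∘ (E + u)^n, and the Frobenius–Euler
--     polynomials satisfy the difference equation
--        H^(α+1)_k(y+1) - λ H^(α+1)_k(y) = (1-λ) H^(α)_k(y),
--     so (E + u)^n sends  l ↦ H^(n)_k(x+l)  to  l ↦ (1-λ)^n (x+l)^k.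
--   * The factor (1-λ)^n cancels against μ^n = (1-λ)^(-n).
-- The difference equation is a statement about exponential generating
-- functions: H^(α+1) is the binomial convolution B ⋆ H^(α), and the
-- Frobenius–Euler numbers B satisfy B ⋆ (coefficients of e^t - λ) = (1-λ)·δ.

open import Defs
open import Level using (Level)
open import Algebra.Bundles using (CommutativeRing)
open import Data.Nat as ℕ using (ℕ; zero; suc; _≤_; z≤n; s≤s; _≤?_; _∸_; _!; NonZero)
import Data.Nat.Properties as ℕP
open import Data.Nat.Combinatorics using (_C_)
import Data.Nat.Combinatorics as ℕC
open import Data.Nat.DivMod using (m/n*n≡m)
open import Data.Nat.Solver using (module +-*-Solver)
open import Data.Integer as ℤ using (+_)
import Data.Integer.Properties as ℤP
open import Data.Sum using (inj₁; inj₂)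
open import Data.Empty using (⊥-elim)
open import Relation.Nullary using (yes; no)
import Relation.Binary.PropositionalEquality as P
open P using (_≡_)
import Algebra.Properties.Ring as RingProperties
import Algebra.Properties.Group as GroupProperties
import Algebra.Properties.Semiring.Exp as SemiringExp
import Algebra.Properties.CommutativeSemiring.Exp as CommSemiringExp
import Algebra.Properties.Semiring.Mult as SemiringMult
import Algebra.Solver.Ring.NaturalCoefficients.Default as CommSemiringSolver
import Relation.Binary.Reasoning.Setoid as SetoidReasoning

choose-factorial : ∀ {n k} → k ≤ n → (n C k) ℕ.* (k ! ℕ.* (n ∸ k) !) ≡ n !
choose-factorial {n} {k} k≤n =
  P.trans (P.cong (ℕ._* (k ! ℕ.* (n ∸ k) !)) (ℕC.nCk≡n!/k![n-k]! k≤n))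
          (m/n*n≡m (ℕC.k![n∸k]!∣n! k≤n))
  where
  instance
    _ : NonZero (k ! ℕ.* (n ∸ k) !)
    _ = ℕP._!*_!≢0 k (n ∸ k)

-- Choosing j+i out of n and then j out of those is choosing j out of n and
-- i out of the remaining n-j; this makes binomial convolution associative.
choose-choose : ∀ n j i → j ℕ.+ i ≤ n →
  (n C (j ℕ.+ i)) ℕ.* ((j ℕ.+ i) C j) ≡ (n C j) ℕ.* ((n ∸ j) C i)
choose-choose n j i j+i≤n =
  ℕP.*-cancelʳ-≡ _ _ (j ! ℕ.* (i ! ℕ.* r !)) (P.trans lhs≡n! (P.sym rhs≡n!))
  where
  open +-*-Solver using (solve; _:=_; _:*_)
  r : ℕ
  r = n ∸ j ∸ i
  instance
    _ : NonZero (j ! ℕ.* (i ! ℕ.* r !))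
    _ = ℕP.m*n≢0 (j !) (i ! ℕ.* r !) {{ℕP._!≢0 j}} {{ℕP._!*_!≢0 i r}}
  j≤j+i : j ≤ j ℕ.+ i
  j≤j+i = ℕP.m≤m+n j i
  i≤n∸j : i ≤ n ∸ j
  i≤n∸j = P.subst (_≤ n ∸ j) (ℕP.m+n∸m≡n j i) (ℕP.∸-monoˡ-≤ j j+i≤n)
  inner : ((j ℕ.+ i) C j) ℕ.* (j ! ℕ.* i !) ≡ (j ℕ.+ i) !
  inner = P.subst (λ t → ((j ℕ.+ i) C j) ℕ.* (j ! ℕ.* t !) ≡ (j ℕ.+ i) !)
                  (ℕP.m+n∸m≡n j i) (choose-factorial j≤j+i)
  outer : (n C (j ℕ.+ i)) ℕ.* ((j ℕ.+ i) ! ℕ.* r !) ≡ n !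
  outer = P.subst (λ t → (n C (j ℕ.+ i)) ℕ.* ((j ℕ.+ i) ! ℕ.* t !) ≡ n !)
                  (P.sym (ℕP.∸-+-assoc n j i)) (choose-factorial j+i≤n)
  lhs≡n! : (n C (j ℕ.+ i)) ℕ.* ((j ℕ.+ i) C j) ℕ.* (j ! ℕ.* (i ! ℕ.* r !)) ≡ n !
  lhs≡n! = P.trans
    (solve 5 (λ a b x y z → a :* b :* (x :* (y :* z)) := a :* (b :* (x :* y) :* z)) P.refl
           (n C (j ℕ.+ i)) ((j ℕ.+ i) C j) (j !) (i !) (r !))
    (P.trans (P.cong (λ t → (n C (j ℕ.+ i)) ℕ.* (t ℕ.* r !)) inner) outer)
  rhs≡n! : (n C j) ℕ.* ((n ∸ j) C i) ℕ.* (j ! ℕ.* (i ! ℕ.* r !)) ≡ n !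
  rhs≡n! = P.trans
    (solve 5 (λ a b x y z → a :* b :* (x :* (y :* z)) := a :* (x :* (b :* (y :* z)))) P.refl
           (n C j) ((n ∸ j) C i) (j !) (i !) (r !))
    (P.trans (P.cong (λ t → (n C j) ℕ.* (j ! ℕ.* t)) (choose-factorial i≤n∸j))
             (choose-factorial (ℕP.≤-trans j≤j+i j+i≤n)))

module FrobeniusEulerLemmas {c ℓ : Level} (R : CommutativeRing c ℓ) where
  open CommutativeRing R hiding (zero)
  open FrobeniusEuler R
  open CommSemiringSolver commutativeSemiring using (solve; _:=_; _:+_; _:*_; con)
  open SetoidReasoning setoid
  open RingProperties ring using (-‿distribˡ-*; -‿distribʳ-*)
  open GroupProperties +-group using (⁻¹-involutive)
  private
    module Exp = SemiringExp semiring
    module Mult = SemiringMult semiring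

  fromℕ≡× : ∀ n → fromℕ n ≡ n Mult.× 1#
  fromℕ≡× zero    = P.refl
  fromℕ≡× (suc n) = P.cong (λ t → 1# + t) (fromℕ≡× n)

  ^≡library-^ : ∀ x n → x ^ n ≡ x Exp.^ n
  ^≡library-^ x zero    = P.refl
  ^≡library-^ x (suc n) = P.cong (x *_) (^≡library-^ x n)

  fromℕ-1 : fromℕ 1 ≈ 1#
  fromℕ-1 = +-identityʳ 1#

  fromℕ-+ : ∀ a b → fromℕ (a ℕ.+ b) ≈ fromℕ a + fromℕ b
  fromℕ-+ a b rewrite fromℕ≡× (a ℕ.+ b) | fromℕ≡× a | fromℕ≡× b = Mult.×-homo-+ 1# a b

  fromℕ-* : ∀ a b → fromℕ (a ℕ.* b) ≈ fromℕ a * fromℕ b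
  fromℕ-* a b rewrite fromℕ≡× (a ℕ.* b) | fromℕ≡× a | fromℕ≡× b = Mult.×1-homo-* a b

  ^-congˡ : ∀ {x y} n → x ≈ y → x ^ n ≈ y ^ n
  ^-congˡ {x} {y} n x≈y rewrite ^≡library-^ x n | ^≡library-^ y n = Exp.^-congˡ n x≈y

  ^-+ : ∀ x a b → x ^ (a ℕ.+ b) ≈ x ^ a * x ^ b
  ^-+ x a b rewrite ^≡library-^ x (a ℕ.+ b) | ^≡library-^ x a | ^≡library-^ x b = Exp.^-homo-* x a b

  ^-distrib-* : ∀ x y n → (x * y) ^ n ≈ x ^ n * y ^ n
  ^-distrib-* x y n rewrite ^≡library-^ (x * y) n | ^≡library-^ x n | ^≡library-^ y n =
    CommSemiringExp.^-distrib-* commutativeSemiring x y n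

  1^ : ∀ n → 1# ^ n ≈ 1#
  1^ zero    = refl
  1^ (suc n) = trans (*-identityˡ _) (1^ n)

  ^-inverse : ∀ x y n → x * y ≈ 1# → x ^ n * y ^ n ≈ 1#
  ^-inverse x y n xy≈1 = trans (sym (^-distrib-* x y n)) (trans (^-congˡ n xy≈1) (1^ n))

  Σ-cong : ∀ n {f g : ℕ → Carrier} → (∀ i → i ≤ n → f i ≈ g i) → sumTo n f ≈ sumTo n g
  Σ-cong zero    f≈g = f≈g 0 z≤n
  Σ-cong (suc n) f≈g = +-cong (Σ-cong n (λ i i≤n → f≈g i (ℕP.m≤n⇒m≤1+n i≤n))) (f≈g (suc n) ℕP.≤-refl)

  Σ-cong′ : ∀ n {f g : ℕ → Carrier} → (∀ i → f i ≈ g i) → sumTo n f ≈ sumTo n g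
  Σ-cong′ n f≈g = Σ-cong n (λ i _ → f≈g i)

  Σ-+ : ∀ n (f g : ℕ → Carrier) → sumTo n (λ i → f i + g i) ≈ sumTo n f + sumTo n g
  Σ-+ zero    f g = refl
  Σ-+ (suc n) f g = trans (+-congʳ (Σ-+ n f g))
    (solve 4 (λ a b c d → (a :+ b) :+ (c :+ d) := (a :+ c) :+ (b :+ d)) refl
           (sumTo n f) (sumTo n g) (f (suc n)) (g (suc n)))

  Σ-*ˡ : ∀ n a (f : ℕ → Carrier) → a * sumTo n f ≈ sumTo n (λ i → a * f i)
  Σ-*ˡ zero    a f = refl
  Σ-*ˡ (suc n) a f = trans (distribˡ _ _ _) (+-congʳ (Σ-*ˡ n a f))

  Σ-*ʳ : ∀ n a (f : ℕ → Carrier) → sumTo n f * a ≈ sumTo n (λ i → f i * a)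
  Σ-*ʳ n a f = trans (*-comm _ _) (trans (Σ-*ˡ n a f) (Σ-cong′ n (λ i → *-comm _ _)))

  Σ-zero : ∀ n (f : ℕ → Carrier) → (∀ i → i ≤ n → f i ≈ 0#) → sumTo n f ≈ 0#
  Σ-zero n f f≈0 = trans (Σ-cong n f≈0) (zeros n)
    where
    zeros : ∀ n → sumTo n (λ _ → 0#) ≈ 0#
    zeros zero    = refl
    zeros (suc n) = trans (+-identityʳ _) (zeros n)

  Σ-shift : ∀ n (f : ℕ → Carrier) → sumTo (suc n) f ≈ f 0 + sumTo n (λ i → f (suc i))
  Σ-shift zero    f = refl
  Σ-shift (suc n) f = trans (+-congʳ (Σ-shift n f)) (+-assoc _ _ _)

  Σ-reverse : ∀ n (f : ℕ → Carrier) → sumTo n f ≈ sumTo n (λ i → f (n ∸ i))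
  Σ-reverse zero    f = refl
  Σ-reverse (suc n) f = begin
    sumTo n f + f (suc n)                     ≈⟨ +-comm _ _ ⟩
    f (suc n) + sumTo n f                     ≈⟨ +-congˡ (Σ-reverse n f) ⟩
    f (suc n) + sumTo n (λ i → f (n ∸ i))     ≈⟨ Σ-shift n (λ i → f (suc n ∸ i)) ⟨
    sumTo (suc n) (λ i → f (suc n ∸ i))       ∎

  Σ-triangle : ∀ n (F : ℕ → ℕ → Carrier) →
    sumTo n (λ k → sumTo k (F k)) ≈ sumTo n (λ j → sumTo (n ∸ j) (λ i → F (j ℕ.+ i) j))
  Σ-triangle zero    F = refl
  Σ-triangle (suc n) F = begin
    sumTo n (λ k → sumTo k (F k)) + (sumTo n (F (suc n)) + F (suc n) (suc n))
      ≈⟨ +-congʳ (Σ-triangle n F) ⟩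
    sumTo n (λ j → sumTo (n ∸ j) (G j)) + (sumTo n (F (suc n)) + F (suc n) (suc n))
      ≈⟨ +-assoc _ _ _ ⟨
    (sumTo n (λ j → sumTo (n ∸ j) (G j)) + sumTo n (F (suc n))) + F (suc n) (suc n)
      ≈⟨ +-cong (Σ-+ n _ _) last ⟨
    sumTo n (λ j → sumTo (n ∸ j) (G j) + F (suc n) j) + sumTo (n ∸ n) (G (suc n))
      ≈⟨ +-congʳ (Σ-cong n extend) ⟩
    sumTo n (λ j → sumTo (suc n ∸ j) (G j)) + sumTo (suc n ∸ suc n) (G (suc n))
      ∎
    where
    G : ℕ → ℕ → Carrier
    G j i = F (j ℕ.+ i) j
    last : sumTo (n ∸ n) (G (suc n)) ≈ F (suc n) (suc n)
    last rewrite ℕP.n∸n≡0 n | ℕP.+-identityʳ n = refl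
    extend : ∀ j → j ≤ n → sumTo (n ∸ j) (G j) + F (suc n) j ≈ sumTo (suc n ∸ j) (G j)
    extend j j≤n rewrite ℕP.+-∸-assoc 1 j≤n =
      +-congˡ (reflexive (P.cong (λ t → F t j)
        (P.sym (P.trans (ℕP.+-suc j (n ∸ j)) (P.cong suc (ℕP.m+[n∸m]≡n j≤n))))))

  infix 4 _≋_
  _≋_ : (ℕ → Carrier) → (ℕ → Carrier) → Set ℓ
  f ≋ g = ∀ k → f k ≈ g k

  ⋆-congˡ : ∀ f {g g′} → g ≋ g′ → f ⋆ g ≋ f ⋆ g′
  ⋆-congˡ f g≋g′ n = Σ-cong′ n (λ k → *-congˡ (*-congˡ (g≋g′ (n ∸ k))))

  ⋆-congʳ : ∀ {f f′} g → f ≋ f′ → f ⋆ g ≋ f′ ⋆ g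
  ⋆-congʳ g f≋f′ n = Σ-cong′ n (λ k → *-congˡ (*-congʳ (f≋f′ k)))

  ⋆-comm : ∀ f g → f ⋆ g ≋ g ⋆ f
  ⋆-comm f g n = trans (Σ-reverse n _) (Σ-cong n swap)
    where
    swap : ∀ k → k ≤ n →
      fromℕ (n C (n ∸ k)) * (f (n ∸ k) * g (n ∸ (n ∸ k))) ≈ fromℕ (n C k) * (g k * f (n ∸ k))
    swap k k≤n rewrite P.sym (ℕC.nCk≡nC[n∸k] k≤n) | ℕP.m∸[m∸n]≡n k≤n = *-congˡ (*-comm _ _)

  ⋆-identityʳ : ∀ f → f ⋆ δ ≋ f
  ⋆-identityʳ f zero    = trans (*-congʳ fromℕ-1) (trans (*-identityˡ _) (*-identityʳ _))
  ⋆-identityʳ f (suc n) = begin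
    sumTo n (λ k → fromℕ (suc n C k) * (f k * δ (suc n ∸ k)))
      + fromℕ (suc n C suc n) * (f (suc n) * δ (n ∸ n))
      ≈⟨ +-cong (Σ-zero n _ below) top ⟩
    0# + f (suc n)
      ≈⟨ +-identityˡ _ ⟩
    f (suc n) ∎
    where
    below : ∀ k → k ≤ n → fromℕ (suc n C k) * (f k * δ (suc n ∸ k)) ≈ 0#
    below k k≤n rewrite ℕP.+-∸-assoc 1 k≤n = trans (*-congˡ (zeroʳ _)) (zeroʳ _)
    top : fromℕ (suc n C suc n) * (f (suc n) * δ (n ∸ n)) ≈ f (suc n)
    top rewrite ℕC.nCn≡1 (suc n) | ℕP.n∸n≡0 n =
      trans (*-congʳ fromℕ-1) (trans (*-identityˡ _) (*-identityʳ _))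

  ⋆-identityˡ : ∀ f → δ ⋆ f ≋ f
  ⋆-identityˡ f n = trans (⋆-comm δ f n) (⋆-identityʳ f n)

  ⋆-distribˡ-+ : ∀ f g h → f ⋆ (λ i → g i + h i) ≋ (λ n → (f ⋆ g) n + (f ⋆ h) n)
  ⋆-distribˡ-+ f g h n =
    trans (Σ-cong′ n (λ k → trans (*-congˡ (distribˡ _ _ _)) (distribˡ _ _ _))) (Σ-+ n _ _)

  ⋆-scalarʳ : ∀ a f g → f ⋆ (λ i → a * g i) ≋ (λ n → a * (f ⋆ g) n)
  ⋆-scalarʳ a f g n = trans
    (Σ-cong′ n (λ k → solve 4 (λ c x y z → c :* (x :* (y :* z)) := y :* (c :* (x :* z))) refl _ _ a _))
    (sym (Σ-*ˡ n a _))

  ⋆-scalarˡ : ∀ a f g → (λ i → a * f i) ⋆ g ≋ (λ n → a * (f ⋆ g) n)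
  ⋆-scalarˡ a f g n = trans (⋆-comm _ g n) (trans (⋆-scalarʳ a g f n) (*-congˡ (⋆-comm g f n)))

  -- Associativity: expand both sides into double sums, exchange the order of
  -- summation and match the binomial coefficients with choose-choose.
  ⋆-assoc : ∀ f g h → (f ⋆ g) ⋆ h ≋ f ⋆ (g ⋆ h)
  ⋆-assoc f g h n = begin
    sumTo n (λ k → fromℕ (n C k) * ((f ⋆ g) k * h (n ∸ k)))
      ≈⟨ Σ-cong′ n (λ k → trans (*-congˡ (Σ-*ʳ k _ _)) (Σ-*ˡ k _ _)) ⟩
    sumTo n (λ k → sumTo k (T k))
      ≈⟨ Σ-triangle n T ⟩
    sumTo n (λ j → sumTo (n ∸ j) (λ i → T (j ℕ.+ i) j))
      ≈⟨ Σ-cong n (λ j j≤n → Σ-cong (n ∸ j) (λ i i≤n∸j → T≈U j i j≤n i≤n∸j)) ⟩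
    sumTo n (λ j → sumTo (n ∸ j) (U j))
      ≈⟨ Σ-cong′ n (λ j → trans (sym (Σ-*ˡ (n ∸ j) _ _)) (*-congˡ (sym (Σ-*ˡ (n ∸ j) _ _)))) ⟩
    sumTo n (λ j → fromℕ (n C j) * (f j * (g ⋆ h) (n ∸ j))) ∎
    where
    T : ℕ → ℕ → Carrier
    T k j = fromℕ (n C k) * ((fromℕ (k C j) * (f j * g (k ∸ j))) * h (n ∸ k))
    U : ℕ → ℕ → Carrier
    U j i = fromℕ (n C j) * (f j * (fromℕ ((n ∸ j) C i) * (g i * h (n ∸ j ∸ i))))
    T≈U : ∀ j i → j ≤ n → i ≤ n ∸ j → T (j ℕ.+ i) j ≈ U j i
    T≈U j i j≤n i≤n∸j = begin
      T (j ℕ.+ i) j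
        ≡⟨ P.cong₂ (λ s t → fromℕ (n C (j ℕ.+ i)) * ((fromℕ ((j ℕ.+ i) C j) * (f j * g s)) * h t))
                   (ℕP.m+n∸m≡n j i) (P.sym (ℕP.∸-+-assoc n j i)) ⟩
      fromℕ (n C (j ℕ.+ i)) * ((fromℕ ((j ℕ.+ i) C j) * (f j * g i)) * h (n ∸ j ∸ i))
        ≈⟨ solve 5 (λ a b x y z → a :* ((b :* (x :* y)) :* z) := (a :* b) :* (x :* (y :* z))) refl _ _ _ _ _ ⟩
      (fromℕ (n C (j ℕ.+ i)) * fromℕ ((j ℕ.+ i) C j)) * (f j * (g i * h (n ∸ j ∸ i)))
        ≈⟨ *-congʳ (fromℕ-* (n C (j ℕ.+ i)) ((j ℕ.+ i) C j)) ⟨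
      fromℕ ((n C (j ℕ.+ i)) ℕ.* ((j ℕ.+ i) C j)) * (f j * (g i * h (n ∸ j ∸ i)))
        ≡⟨ P.cong (λ m → fromℕ m * (f j * (g i * h (n ∸ j ∸ i)))) (choose-choose n j i j+i≤n) ⟩
      fromℕ ((n C j) ℕ.* ((n ∸ j) C i)) * (f j * (g i * h (n ∸ j ∸ i)))
        ≈⟨ *-congʳ (fromℕ-* (n C j) ((n ∸ j) C i)) ⟩
      (fromℕ (n C j) * fromℕ ((n ∸ j) C i)) * (f j * (g i * h (n ∸ j ∸ i)))
        ≈⟨ solve 5 (λ a b x y z → (a :* b) :* (x :* (y :* z)) := a :* (x :* (b :* (y :* z)))) refl _ _ _ _ _ ⟩
      U j i ∎
      where
      j+i≤n : j ℕ.+ i ≤ n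
      j+i≤n = P.subst (j ℕ.+ i ≤_) (ℕP.m+[n∸m]≡n j≤n) (ℕP.+-monoʳ-≤ j i≤n∸j)

  -- The operator E + u on sequences (E the shift g ↦ g ∘ suc), its iterates,
  -- and the binomial expansion  ((E + u)^j g)(0) = Σ_l C(j,l) u^(j-l) g l.

  Δ : Carrier → (ℕ → Carrier) → (ℕ → Carrier)
  Δ u g l = g (suc l) + u * g l

  Δ^ : Carrier → ℕ → (ℕ → Carrier) → (ℕ → Carrier)
  Δ^ u zero    g = g
  Δ^ u (suc n) g = Δ^ u n (Δ u g)

  shiftExpansion : Carrier → ℕ → (ℕ → Carrier) → Carrier
  shiftExpansion u j g = sumTo j (λ l → fromℕ (j C l) * (u ^ (j ∸ l) * g l))

  Δ^-cong : ∀ u n {g h} → g ≋ h → Δ^ u n g ≋ Δ^ u n h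
  Δ^-cong u zero    g≋h = g≋h
  Δ^-cong u (suc n) g≋h = Δ^-cong u n (λ l → +-cong (g≋h (suc l)) (*-congˡ (g≋h l)))

  Δ^-scalar : ∀ u n a g → Δ^ u n (λ l → a * g l) ≋ (λ l → a * Δ^ u n g l)
  Δ^-scalar u zero    a g l = refl
  Δ^-scalar u (suc n) a g l = trans
    (Δ^-cong u n (λ m → solve 4 (λ a p q u → a :* p :+ u :* (a :* q) := a :* (p :+ u :* q))
                                refl a (g (suc m)) (g m) u) l)
    (Δ^-scalar u n a (Δ u g) l)

  shiftExpansion-cong : ∀ u j {g h} → g ≋ h → shiftExpansion u j g ≈ shiftExpansion u j h
  shiftExpansion-cong u j g≋h = Σ-cong′ j (λ l → *-congˡ (*-congˡ (g≋h l)))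

  shiftExpansion-scalar : ∀ u j a g → shiftExpansion u j (λ l → a * g l) ≈ a * shiftExpansion u j g
  shiftExpansion-scalar u j a g = trans
    (Σ-cong′ j (λ l → solve 4 (λ c w a q → c :* (w :* (a :* q)) := a :* (c :* (w :* q))) refl _ _ a _))
    (sym (Σ-*ˡ j a _))

  -- (E + u)^(j+1) = (E + u)^j ∘ (E + u): Pascal's rule C(j+1,l+1) = C(j,l) + C(j,l+1)
  -- splits the expansion into the E-part and the u-part.
  shiftExpansion-step : ∀ u j g → shiftExpansion u (suc j) g ≈ shiftExpansion u j (Δ u g)
  shiftExpansion-step u j g = begin
    shiftExpansion u (suc j) g
      ≈⟨ Σ-shift j _ ⟩
    first + sumTo j (λ l → fromℕ (suc j C suc l) * (u ^ (j ∸ l) * g (suc l)))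
      ≈⟨ +-congˡ (trans (Σ-cong′ j pascal) (Σ-+ j _ _)) ⟩
    first + (shiftPart + upperPart)
      ≈⟨ solve 3 (λ a b c → a :+ (b :+ c) := b :+ (c :+ a)) refl first shiftPart upperPart ⟩
    shiftPart + (upperPart + first)
      ≈⟨ +-congˡ (trans (+-comm _ _) (sym (Σ-shift j (λ l → fromℕ (j C l) * (u ^ (suc j ∸ l) * g l))))) ⟩
    shiftPart + (sumTo j (λ l → fromℕ (j C l) * (u ^ (suc j ∸ l) * g l))
                 + fromℕ (j C suc j) * (u ^ (j ∸ j) * g (suc j)))
      ≈⟨ +-congˡ (+-cong (Σ-cong j pull-u) vanishing) ⟩
    shiftPart + (scalePart + 0#)
      ≈⟨ +-congˡ (+-identityʳ _) ⟩
    shiftPart + scalePart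
      ≈⟨ Σ-+ j _ _ ⟨
    sumTo j (λ l → fromℕ (j C l) * (u ^ (j ∸ l) * g (suc l)) + fromℕ (j C l) * (u ^ (j ∸ l) * (u * g l)))
      ≈⟨ Σ-cong′ j (λ l → sym (trans (*-congˡ (distribˡ _ _ _)) (distribˡ _ _ _))) ⟩
    shiftExpansion u j (Δ u g) ∎
    where
    first shiftPart upperPart scalePart : Carrier
    first = fromℕ (j C 0) * (u ^ suc j * g 0)
    shiftPart = sumTo j (λ l → fromℕ (j C l) * (u ^ (j ∸ l) * g (suc l)))
    upperPart = sumTo j (λ l → fromℕ (j C suc l) * (u ^ (j ∸ l) * g (suc l)))
    scalePart = sumTo j (λ l → fromℕ (j C l) * (u ^ (j ∸ l) * (u * g l)))
    pascal : ∀ l → fromℕ (suc j C suc l) * (u ^ (j ∸ l) * g (suc l))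
                 ≈ fromℕ (j C l) * (u ^ (j ∸ l) * g (suc l)) + fromℕ (j C suc l) * (u ^ (j ∸ l) * g (suc l))
    pascal l rewrite P.sym (ℕC.nCk+nC[k+1]≡[n+1]C[k+1] j l) =
      trans (*-congʳ (fromℕ-+ (j C l) (j C suc l))) (distribʳ _ _ _)
    pull-u : ∀ l → l ≤ j → fromℕ (j C l) * (u ^ (suc j ∸ l) * g l) ≈ fromℕ (j C l) * (u ^ (j ∸ l) * (u * g l))
    pull-u l l≤j rewrite ℕP.+-∸-assoc 1 l≤j =
      *-congˡ (solve 3 (λ a b c → (a :* b) :* c := b :* (a :* c)) refl u (u ^ (j ∸ l)) (g l))
    vanishing : fromℕ (j C suc j) * (u ^ (j ∸ j) * g (suc j)) ≈ 0#
    vanishing rewrite ℕC.k>n⇒nCk≡0 (ℕP.n<1+n j) = zeroˡ _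

  shiftExpansion-iterate : ∀ u n j g → shiftExpansion u (n ℕ.+ j) g ≈ shiftExpansion u j (Δ^ u n g)
  shiftExpansion-iterate u zero    j g = refl
  shiftExpansion-iterate u (suc n) j g =
    trans (shiftExpansion-step u (n ℕ.+ j) g) (shiftExpansion-iterate u n j (Δ u g))

  -- The binomial theorem, in the form  e^(yt)·e^t = e^((y+1)t)  on coefficients.
  binomial : ∀ y k → ((λ i → y ^ i) ⋆ (λ i → 1# ^ i)) k ≈ (y + 1#) ^ k
  binomial y k = trans (Σ-cong′ k (λ l → *-congˡ (*-comm _ _))) (expansion k)
    where
    expansion : ∀ k → shiftExpansion 1# k (λ i → y ^ i) ≈ (y + 1#) ^ k
    expansion zero    = trans (*-congʳ fromℕ-1) (trans (*-identityˡ _) (*-identityˡ _))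
    expansion (suc k) = begin
      shiftExpansion 1# (suc k) (λ i → y ^ i)
        ≈⟨ shiftExpansion-step 1# k _ ⟩
      shiftExpansion 1# k (Δ 1# (λ i → y ^ i))
        ≈⟨ shiftExpansion-cong 1# k (λ i → solve 2 (λ y p → y :* p :+ con 1 :* p := (y :+ con 1) :* p) refl y (y ^ i)) ⟩
      shiftExpansion 1# k (λ i → (y + 1#) * y ^ i)
        ≈⟨ shiftExpansion-scalar 1# k (y + 1#) _ ⟩
      (y + 1#) * shiftExpansion 1# k (λ i → y ^ i)
        ≈⟨ *-congˡ (expansion k) ⟩
      (y + 1#) ^ suc k ∎

  tab-stable : ∀ μ n j → j ≤ n → tab μ n j ≡ FEnum μ j
  tab-stable μ zero    .zero z≤n = P.refl
  tab-stable μ (suc n) j j≤1+n with ℕP.m≤n⇒m<n∨m≡n j≤1+n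
  ... | inj₂ P.refl = P.refl
  ... | inj₁ (s≤s j≤n) with j ≤? n
  ...   | yes _   = tab-stable μ n j j≤n
  ...   | no  j≰n = ⊥-elim (j≰n j≤n)

  FEnum-recurrence : ∀ μ n → FEnum μ (suc n) ≡ - (μ * sumTo n (λ i → fromℕ (suc n C i) * tab μ n i))
  FEnum-recurrence μ n with suc n ≤? n
  ... | yes 1+n≤n = ⊥-elim (ℕP.<-irrefl P.refl 1+n≤n)
  ... | no  _     = P.refl

  -- Coefficients of e^t - λ.
  denominator : Carrier → ℕ → Carrier
  denominator lam i = 1# ^ i + (- lam) * δ i

  module _ (lam μ : Carrier) (1-λ*μ≈1 : (1# - lam) * μ ≈ 1#) where

    FEnum⋆denominator : FEnum μ ⋆ denominator lam ≋ (λ k → (1# - lam) * δ k)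
    FEnum⋆denominator zero = begin
      fromℕ 1 * (1# * (1# + (- lam) * 1#)) ≈⟨ *-congʳ fromℕ-1 ⟩
      1# * (1# * (1# + (- lam) * 1#))     ≈⟨ trans (*-identityˡ _) (*-identityˡ _) ⟩
      1# + (- lam) * 1#                    ≈⟨ +-congˡ (*-identityʳ _) ⟩
      1# - lam                             ≈⟨ *-identityʳ _ ⟨
      (1# - lam) * 1#                      ∎
    FEnum⋆denominator (suc K) = begin
      sumTo K (λ j → fromℕ (suc K C j) * (FEnum μ j * denominator lam (suc K ∸ j)))
        + fromℕ (suc K C suc K) * (FEnum μ (suc K) * denominator lam (K ∸ K))
        ≈⟨ +-cong (Σ-cong K lower) top ⟩
      S + - (μ * S) * (1# - lam)
        ≈⟨ +-congˡ (-‿distribˡ-* _ _) ⟨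
      S + - (μ * S * (1# - lam))
        ≈⟨ +-congˡ (-‿cong cancel) ⟩
      S + - S
        ≈⟨ -‿inverseʳ S ⟩
      0#
        ≈⟨ zeroʳ _ ⟨
      (1# - lam) * 0# ∎
      where
      S : Carrier
      S = sumTo K (λ i → fromℕ (suc K C i) * tab μ K i)
      lower : ∀ j → j ≤ K →
        fromℕ (suc K C j) * (FEnum μ j * denominator lam (suc K ∸ j)) ≈ fromℕ (suc K C j) * tab μ K j
      lower j j≤K rewrite ℕP.+-∸-assoc 1 j≤K | tab-stable μ K j j≤K =
        *-congˡ (trans (*-congˡ (trans (+-cong (1^ (suc (K ∸ j))) (zeroʳ _)) (+-identityʳ _))) (*-identityʳ _))
      top : fromℕ (suc K C suc K) * (FEnum μ (suc K) * denominator lam (K ∸ K)) ≈ - (μ * S) * (1# - lam)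
      top rewrite ℕC.nCn≡1 (suc K) | ℕP.n∸n≡0 K | FEnum-recurrence μ K =
        trans (*-congʳ fromℕ-1) (trans (*-identityˡ _) (*-congˡ (+-congˡ (*-identityʳ _))))
      cancel : μ * S * (1# - lam) ≈ S
      cancel = trans (solve 3 (λ m s l → m :* s :* l := l :* m :* s) refl μ S (1# - lam))
                     (trans (*-congʳ 1-λ*μ≈1) (*-identityˡ S))

    exp⋆denominator : ∀ y → (λ i → y ^ i) ⋆ denominator lam ≋ (λ k → (y + 1#) ^ k + (- lam) * y ^ k)
    exp⋆denominator y k = begin
      ((λ i → y ^ i) ⋆ denominator lam) k
        ≈⟨ ⋆-distribˡ-+ (λ i → y ^ i) (λ i → 1# ^ i) (λ i → (- lam) * δ i) k ⟩
      ((λ i → y ^ i) ⋆ (λ i → 1# ^ i)) k + ((λ i → y ^ i) ⋆ (λ i → (- lam) * δ i)) k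
        ≈⟨ +-cong (binomial y k) (⋆-scalarʳ (- lam) (λ i → y ^ i) δ k) ⟩
      (y + 1#) ^ k + (- lam) * ((λ i → y ^ i) ⋆ δ) k
        ≈⟨ +-congˡ (*-congˡ (⋆-identityʳ (λ i → y ^ i) k)) ⟩
      (y + 1#) ^ k + (- lam) * y ^ k ∎

    -- Since H^(α+1) = B ⋆ H^(α), multiply by 1-λ = B ⋆ (e^t - λ) and regroup.
    H-difference : ∀ α k y → H μ (suc α) k (y + 1#) + (- lam) * H μ (suc α) k y ≈ (1# - lam) * H μ α k y
    H-difference α k y = sym (begin
      (1# - lam) * (F ⋆ e y) k
        ≈⟨ trans (⋆-scalarˡ (1# - lam) δ (F ⋆ e y) k) (*-congˡ (⋆-identityˡ (F ⋆ e y) k)) ⟨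
      ((λ i → (1# - lam) * δ i) ⋆ (F ⋆ e y)) k
        ≈⟨ ⋆-congʳ (F ⋆ e y) FEnum⋆denominator k ⟨
      ((B ⋆ D) ⋆ (F ⋆ e y)) k
        ≈⟨ ⋆-assoc B D (F ⋆ e y) k ⟩
      (B ⋆ (D ⋆ (F ⋆ e y))) k
        ≈⟨ ⋆-congˡ B (λ i → trans (⋆-comm D (F ⋆ e y) i) (⋆-assoc F (e y) D i)) k ⟩
      (B ⋆ (F ⋆ (e y ⋆ D))) k
        ≈⟨ ⋆-assoc B F (e y ⋆ D) k ⟨
      ((B ⋆ F) ⋆ (e y ⋆ D)) k
        ≈⟨ ⋆-congˡ (B ⋆ F) (exp⋆denominator y) k ⟩
      ((B ⋆ F) ⋆ (λ i → e (y + 1#) i + (- lam) * e y i)) k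
        ≈⟨ ⋆-distribˡ-+ (B ⋆ F) (e (y + 1#)) (λ i → (- lam) * e y i) k ⟩
      ((B ⋆ F) ⋆ e (y + 1#)) k + ((B ⋆ F) ⋆ (λ i → (- lam) * e y i)) k
        ≈⟨ +-congˡ (⋆-scalarʳ (- lam) (B ⋆ F) (e y) k) ⟩
      H μ (suc α) k (y + 1#) + (- lam) * H μ (suc α) k y ∎)
      where
      B F D : ℕ → Carrier
      B = FEnum μ
      F = FEpow μ α
      D = denominator lam
      e : Carrier → ℕ → Carrier
      e z i = z ^ i

    H-cong : ∀ m k {y z} → y ≈ z → H μ m k y ≈ H μ m k z
    H-cong m k y≈z = ⋆-congˡ (FEpow μ m) (λ i → ^-congˡ i y≈z) k

    Δ^-H : ∀ n k x → Δ^ (- lam) n (λ l → H μ n k (x + fromℕ l)) ≋ (λ l → (1# - lam) ^ n * (x + fromℕ l) ^ k)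
    Δ^-H zero    k x l = trans (⋆-identityˡ (λ i → (x + fromℕ l) ^ i) k) (sym (*-identityˡ _))
    Δ^-H (suc n) k x l = begin
      Δ^ (- lam) n (Δ (- lam) (λ m → H μ (suc n) k (x + fromℕ m))) l
        ≈⟨ Δ^-cong (- lam) n one-step l ⟩
      Δ^ (- lam) n (λ m → (1# - lam) * H μ n k (x + fromℕ m)) l
        ≈⟨ Δ^-scalar (- lam) n (1# - lam) _ l ⟩
      (1# - lam) * Δ^ (- lam) n (λ m → H μ n k (x + fromℕ m)) l
        ≈⟨ *-congˡ (Δ^-H n k x l) ⟩
      (1# - lam) * ((1# - lam) ^ n * (x + fromℕ l) ^ k)
        ≈⟨ *-assoc _ _ _ ⟨
      (1# - lam) ^ suc n * (x + fromℕ l) ^ k ∎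
      where
      one-step : Δ (- lam) (λ m → H μ (suc n) k (x + fromℕ m)) ≋ (λ m → (1# - lam) * H μ n k (x + fromℕ m))
      one-step m = trans
        (+-congʳ (H-cong (suc n) k (solve 3 (λ x a b → x :+ (a :+ b) := (x :+ b) :+ a) refl x 1# (fromℕ m))))
        (H-difference n k (x + fromℕ m))

  -- -λ⁻¹ is the inverse of -λ.
  neg*neg : ∀ x y → (- x) * (- y) ≈ x * y
  neg*neg x y = begin
    (- x) * (- y)   ≈⟨ -‿distribˡ-* x (- y) ⟨
    - (x * (- y))   ≈⟨ -‿cong (-‿distribʳ-* x y) ⟨
    - (- (x * y))   ≈⟨ ⁻¹-involutive (x * y) ⟩
    x * y           ∎

  module _ (u v : Carrier) (v*u≈1 : v * u ≈ 1#) where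

    zpow-neg : ∀ d → zpow u v (ℤ.- (+ d)) ≡ v ^ d
    zpow-neg zero    = P.refl
    zpow-neg (suc d) = P.refl

    cancelˡ : ∀ m r → v ^ m * u ^ (m ℕ.+ r) ≈ u ^ r
    cancelˡ m r = begin
      v ^ m * u ^ (m ℕ.+ r)      ≈⟨ *-congˡ (^-+ u m r) ⟩
      v ^ m * (u ^ m * u ^ r)    ≈⟨ *-assoc _ _ _ ⟨
      (v ^ m * u ^ m) * u ^ r    ≈⟨ *-congʳ (^-inverse v u m v*u≈1) ⟩
      1# * u ^ r                 ≈⟨ *-identityˡ _ ⟩
      u ^ r                      ∎

    cancelʳ : ∀ m r → v ^ (m ℕ.+ r) * u ^ r ≈ v ^ m
    cancelʳ m r = begin
      v ^ (m ℕ.+ r) * u ^ r      ≈⟨ *-congʳ (^-+ v m r) ⟩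
      (v ^ m * v ^ r) * u ^ r    ≈⟨ *-assoc _ _ _ ⟩
      v ^ m * (v ^ r * u ^ r)    ≈⟨ *-congˡ (^-inverse v u r v*u≈1) ⟩
      v ^ m * 1#                 ≈⟨ *-identityʳ _ ⟩
      v ^ m                      ∎

    zpow-⊖ : ∀ N p q → q ≤ p ℕ.+ N → zpow u v (p ℤ.⊖ q) ≈ v ^ N * u ^ (p ℕ.+ N ∸ q)
    zpow-⊖ N p q q≤p+N with ℕP.≤-<-connex q p
    ... | inj₁ q≤p = begin
      zpow u v (p ℤ.⊖ q)             ≡⟨ P.cong (zpow u v) (ℤP.⊖-≥ q≤p) ⟩
      u ^ (p ∸ q)                    ≈⟨ cancelˡ N (p ∸ q) ⟨
      v ^ N * u ^ (N ℕ.+ (p ∸ q))    ≡⟨ P.cong (λ t → v ^ N * u ^ t) N+[p∸q]≡p+N∸q ⟩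
      v ^ N * u ^ (p ℕ.+ N ∸ q)      ∎
      where
      N+[p∸q]≡p+N∸q : N ℕ.+ (p ∸ q) ≡ p ℕ.+ N ∸ q
      N+[p∸q]≡p+N∸q = P.trans (ℕP.+-comm N (p ∸ q)) (P.sym (ℕP.+-∸-comm N q≤p))
    ... | inj₂ p<q = begin
      zpow u v (p ℤ.⊖ q)             ≡⟨ P.cong (zpow u v) (ℤP.⊖-< p<q) ⟩
      zpow u v (ℤ.- (+ (q ∸ p)))     ≡⟨ zpow-neg (q ∸ p) ⟩
      v ^ (q ∸ p)                    ≈⟨ cancelʳ (q ∸ p) r ⟨
      v ^ (q ∸ p ℕ.+ r) * u ^ r      ≡⟨ P.cong (λ t → v ^ t * u ^ r) q∸p+r≡N ⟩
      v ^ N * u ^ r                  ∎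
      where
      r : ℕ
      r = p ℕ.+ N ∸ q
      q∸p+r≡N : q ∸ p ℕ.+ r ≡ N
      q∸p+r≡N = ℕP.+-cancelˡ-≡ p _ _ (P.trans (P.sym (ℕP.+-assoc p (q ∸ p) r))
        (P.trans (P.cong (ℕ._+ r) (ℕP.m+[n∸m]≡n (ℕP.<⇒≤ p<q))) (ℕP.m+[n∸m]≡n q≤p+N)))

    signed-expansion : ∀ p N (g : ℕ → Carrier) →
      sumTo (p ℕ.+ N) (λ l → fromℕ ((p ℕ.+ N) C l) * (zpow u v (p ℤ.⊖ l) * g l))
      ≈ v ^ N * shiftExpansion u (p ℕ.+ N) g
    signed-expansion p N g = trans (Σ-cong (p ℕ.+ N) factor) (sym (Σ-*ˡ (p ℕ.+ N) (v ^ N) _))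
      where
      factor : ∀ l → l ≤ p ℕ.+ N →
        fromℕ ((p ℕ.+ N) C l) * (zpow u v (p ℤ.⊖ l) * g l)
        ≈ v ^ N * (fromℕ ((p ℕ.+ N) C l) * (u ^ (p ℕ.+ N ∸ l) * g l))
      factor l l≤p+N = trans (*-congˡ (*-congʳ (zpow-⊖ N p l l≤p+N)))
        (solve 4 (λ c a b w → c :* ((a :* b) :* w) := a :* (c :* (b :* w))) refl _ _ _ _)

-- With u = -λ, v = -λ⁻¹, N = an, q l = (x+l)^(n-1), s l = H^(n)_(n-1)(x+l):
-- LHS = v^N ((E+u)^N q)(0) and RHS = μ^n v^N ((E+u)^(n+N) s)(0), while
-- (E+u)^(n+N) s = (E+u)^N ((E+u)^n s) = (E+u)^N ((1-λ)^n q) and μ^n (1-λ)^n = 1.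
theorem2 : ∀ {c ℓ : Level} (R : CommutativeRing c ℓ) →
    let open CommutativeRing R
        open FrobeniusEuler R
    in (lam lamInv μ : Carrier) → lam * lamInv ≈ 1# → (1# - lam) * μ ≈ 1# →
       (n : ℕ) → 1 ≤ n → (a : ℕ) → (x : Carrier) →
       sumTo (a ℕ.* n) (λ l → fromℕ ((a ℕ.* n) C l) * (zpow (- lam) (- lamInv) (ℤ.- (+ l)) * ((x + fromℕ l) ^ (n ℕ.∸ 1))))
       ≈ (μ ^ n) * sumTo (suc a ℕ.* n) (λ l → fromℕ ((suc a ℕ.* n) C l) * (zpow (- lam) (- lamInv) (+ n ℤ.- + l) * H μ n (n ℕ.∸ 1) (x + fromℕ l)))
theorem2 R lam lamInv μ λ*λ⁻¹≈1 [1-λ]*μ≈1 n _ a x = begin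
  sumTo N (λ l → fromℕ (N C l) * (zpow u v (ℤ.- (+ l)) * q l))
    ≈⟨ Σ-cong′ N (λ l → *-congˡ (*-congʳ (reflexive (P.cong (zpow u v) (P.sym (ℤP.⊖-≤ {0} {l} z≤n)))))) ⟩
  sumTo N (λ l → fromℕ (N C l) * (zpow u v (0 ℤ.⊖ l) * q l))
    ≈⟨ signed-expansion u v v*u≈1 0 N q ⟩
  v ^ N * shiftExpansion u N q
    ≈⟨ μⁿ-cancels ⟨
  μ ^ n * (v ^ N * ((1# - lam) ^ n * shiftExpansion u N q))
    ≈⟨ *-congˡ (*-congˡ (shiftExpansion-scalar u N ((1# - lam) ^ n) q)) ⟨
  μ ^ n * (v ^ N * shiftExpansion u N (λ l → (1# - lam) ^ n * q l))
    ≈⟨ *-congˡ (*-congˡ (shiftExpansion-cong u N (Δ^-H lam μ [1-λ]*μ≈1 n K x))) ⟨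
  μ ^ n * (v ^ N * shiftExpansion u N (Δ^ u n s))
    ≈⟨ *-congˡ (*-congˡ (shiftExpansion-iterate u n N s)) ⟨
  μ ^ n * (v ^ N * shiftExpansion u (n ℕ.+ N) s)
    ≈⟨ *-congˡ (signed-expansion u v v*u≈1 n N s) ⟨
  μ ^ n * sumTo (n ℕ.+ N) (λ l → fromℕ ((n ℕ.+ N) C l) * (zpow u v (n ℤ.⊖ l) * s l))
    ≈⟨ *-congˡ (Σ-cong′ (n ℕ.+ N) (λ l → *-congˡ (*-congʳ (reflexive (P.cong (zpow u v) (ℤP.m-n≡m⊖n n l)))))) ⟨
  μ ^ n * sumTo (n ℕ.+ N) (λ l → fromℕ ((n ℕ.+ N) C l) * (zpow u v (+ n ℤ.- + l) * s l)) ∎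
  where
  open CommutativeRing R hiding (zero)
  open FrobeniusEuler R
  open FrobeniusEulerLemmas R
  open SetoidReasoning setoid
  u v : Carrier
  u = - lam
  v = - lamInv
  N K : ℕ
  N = a ℕ.* n
  K = n ∸ 1
  q s : ℕ → Carrier
  q l = (x + fromℕ l) ^ K
  s l = H μ n K (x + fromℕ l)
  v*u≈1 : v * u ≈ 1#
  v*u≈1 = trans (neg*neg lamInv lam) (trans (*-comm lamInv lam) λ*λ⁻¹≈1)
  μⁿ-cancels : ∀ {e} → μ ^ n * (v ^ N * ((1# - lam) ^ n * e)) ≈ v ^ N * e
  μⁿ-cancels {e} = trans
    (solve 4 (λ m w l e → m :* (w :* (l :* e)) := (m :* l) :* (w :* e)) refl (μ ^ n) (v ^ N) ((1# - lam) ^ n) e)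
    (trans (*-congʳ (^-inverse μ (1# - lam) n (trans (*-comm μ _) [1-λ]*μ≈1))) (*-identityˡ _))
    where open CommSemiringSolver commutativeSemiring using (solve; _:=_; _:*_)
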